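{- Let $1\leq h<n$ and let $B\in\mathbb F_q[T]$ have degree exactly $n-h-1$. Then $$\nu(T^{h+1}B;h)=\tilde\Psi(n;T^{n-h},B^*).$$
   Context: $\mathcal P_{\leq h}$ is the set of polynomials in $\mathbb F_q[T]$ of degree at most $h$, including $0$. The von Mangoldt function is $\Lambda(N)=\deg P$ if $N=cP^k$ with $P$ monic irreducible, $k\geq1$, $c\in\mathbb F_q^\times$, and $\Lambda(N)=0$ otherwise. For $A$ of degree $n$ and $1\le h<n$, $I(A;h)=A+\mathcal P_{\le h}$ and $\nu(A;h)=\sum_{f\in I(A;h),\ f(0)\neq0}\Lambda(f)$. For $0\neq f$, $f^*(T)=T^{\deg f}f(1/T)$ (the polynomial with reversed coefficients), and $0^*=0$. For $Q$ of positive degree and a polynomial $A$, $\tilde\Psi(n;Q,A)=\sum\Lambda(f)$, the sum over all (not necessarily monic) polynomials $f$ of degree exactly $n$ with $f\equiv A\bmod Q$. -}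

module Defs where

open import Level using (0ℓ)
open import Data.Nat as ℕ using (ℕ; zero; suc; _∸_)
open import Data.Bool using (Bool; true; false; if_then_else_; _∧_)
open import Data.List using (List; []; _∷_; _++_; map; concatMap; replicate; reverse; length; last)
open import Data.Nat.ListAction using (sum)
open import Data.List.Membership.Propositional using (_∈_)
open import Data.List.Relation.Unary.Unique.Propositional using (Unique)
open import Data.Maybe using (just)
open import Data.Product using (Σ; ∃; _×_; _,_)
open import Data.Sum using (_⊎_)
open import Relation.Nullary using (¬_; Dec; does)
open import Relation.Binary.PropositionalEquality using (_≡_; _≢_)
open import Relation.Binary.Definitions using (DecidableEquality)
open import Algebra.Structures using (IsCommutativeRing)

-- A finite field 𝔽_q (q = number of elements of `elems`).

record FiniteField : Set₁ where
  infixl 6 _+_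
  infixl 7 _*_
  field
    F      : Set
    _+_    : F → F → F
    _*_    : F → F → F
    -_     : F → F
    0#     : F
    1#     : F
    isCommutativeRing : IsCommutativeRing _≡_ _+_ _*_ -_ 0# 1#
    _≟_    : DecidableEquality F
    0≢1    : 0# ≢ 1#
    inverse : ∀ x → x ≢ 0# → ∃ λ y → x * y ≡ 1#
    elems    : List F
    complete : ∀ x → x ∈ elems
    unique   : Unique elems

-- Polynomials in 𝔽_q[T] as coefficient lists, lowest degree first.
-- Trailing zeros are allowed in raw lists; two lists represent the same
-- polynomial iff their normalisations (trailing zeros stripped) agree.

module Poly (𝔽 : FiniteField) where
  open FiniteField 𝔽

  Pol : Set
  Pol = List F

  norm : Pol → Pol
  norm [] = []
  norm (x ∷ xs) with norm xs
  ... | [] = if does (x ≟ 0#) then [] else x ∷ []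
  ... | y ∷ ys = x ∷ y ∷ ys

  infix 4 _≈_
  _≈_ : Pol → Pol → Set
  p ≈ q = norm p ≡ norm q

  infixl 6 _⊕_
  _⊕_ : Pol → Pol → Pol
  [] ⊕ ys = ys
  (x ∷ xs) ⊕ [] = x ∷ xs
  (x ∷ xs) ⊕ (y ∷ ys) = (x + y) ∷ (xs ⊕ ys)

  neg : Pol → Pol
  neg = map -_

  scale : F → Pol → Pol
  scale c = map (c *_)

  infixl 7 _⊗_
  _⊗_ : Pol → Pol → Pol
  [] ⊗ ys = []
  (x ∷ xs) ⊗ ys = scale x ys ⊕ (0# ∷ (xs ⊗ ys))

  one : Pol
  one = 1# ∷ []

  Tpow : ℕ → Pol
  Tpow k = replicate k 0# ++ (1# ∷ [])

  pow : Pol → ℕ → Pol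
  pow p zero = one
  pow p (suc k) = p ⊗ pow p k

  HasDegree : Pol → ℕ → Set
  HasDegree f d = length (norm f) ≡ suc d

  -- degree (only meaningful for nonzero f)
  deg : Pol → ℕ
  deg f = length (norm f) ∸ 1

  coeff0 : Pol → F
  coeff0 [] = 0#
  coeff0 (x ∷ _) = x

  -- reversal f* = T^{deg f} f(1/T), with 0* = 0
  _* : Pol → Pol
  f * = reverse (norm f)

  Monic : Pol → Set
  Monic P = last (norm P) ≡ just 1#

  IsUnit : Pol → Set
  IsUnit g = ∃ λ u → g ⊗ u ≈ one

  Irreducible : Pol → Set
  Irreducible P = ¬ IsUnit P × ¬ (P ≈ []) × (∀ g k → P ≈ g ⊗ k → IsUnit g ⊎ IsUnit k)

  PrimePowerRep : Pol → F → Pol → ℕ → Set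
  PrimePowerRep f c P k = c ≢ 0# × Monic P × Irreducible P × 1 ℕ.≤ k × f ≈ scale c (pow P k)

  record IsVonMangoldt (Λ : Pol → ℕ) : Set where
    field
      on-prime-power : ∀ f c P k → PrimePowerRep f c P k → Λ f ≡ deg P
      otherwise      : ∀ f → ¬ (∃ λ c → ∃ λ P → ∃ λ k → PrimePowerRep f c P k) → Λ f ≡ 0

  Divides : Pol → Pol → Set
  Divides Q g = ∃ λ u → g ≈ Q ⊗ u

  -- all coefficient lists of length m (each polynomial of degree < m exactly once)
  allLists : ℕ → List Pol
  allLists zero = [] ∷ []
  allLists (suc m) = concatMap (λ x → map (x ∷_) (allLists m)) elems

  -- ν(A;h) = Σ_{f ∈ A + P_{≤h}, f(0) ≠ 0} Λ(f)
  ν : (Pol → ℕ) → Pol → ℕ → ℕ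
  ν Λ A h = sum (map (λ g → if does (coeff0 (A ⊕ g) ≟ 0#) then 0 else Λ (A ⊕ g))
                     (allLists (suc h)))

  -- Ψ̃(n;Q,A) = Σ_{deg f = n, f ≡ A mod Q} Λ(f); the congruence is decided by
  -- an arbitrary decision procedure for divisibility (the value is independent of it).
  Ψ̃ : (Pol → ℕ) → ((Q g : Pol) → Dec (Divides Q g)) → ℕ → Pol → Pol → ℕ
  Ψ̃ Λ dec n Q A = sum (map (λ f → if does (length (norm f) ℕ.≟ suc n) ∧ does (dec Q (f ⊕ neg A))
                                     then Λ f else 0)
                           (allLists (suc n)))

module Submission where

-- Both sides equal the tail sum  Σ_g Λ(B* ++ g),  over coefficient lists g of
-- length h + 1 with nonzero last entry (deg g = h), where B* ++ g = B* + T^{n-h} g.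
-- Left side: T^{h+1} B + g = g ++ B for |g| = h + 1; when g(0) ≠ 0 reversal does
-- not change Λ, and (g ++ B)* = B* ++ reverse g, so reindexing by g ↦ reverse g
-- turns the condition g(0) ≠ 0 into deg g = h.
-- Right side: each f with n + 1 coefficients is p ++ g with |p| = n - h; the
-- congruence f ≡ B* mod T^{n-h} forces p = B*, and deg f = n iff deg g = h.

open import Defs
open import Data.Nat as ℕ using (ℕ; zero; suc; _≤_; _<_; _∸_; _⊔_; z≤n; s≤s)
import Data.Nat.Properties as ℕₚ
open import Data.Nat.ListAction using (sum)
open import Data.Nat.ListAction.Properties using (sum-++)
open import Data.List using (List; []; _∷_; _++_; map; concatMap; replicate; reverse; length; last)
import Data.List.Properties as Listₚ
open import Data.List.Relation.Unary.All as All using (All)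
open import Data.List.Relation.Unary.AllPairs as AllPairs using (AllPairs)
open import Data.List.Membership.Propositional using (_∈_)
open import Data.List.Relation.Unary.Any using (here; there)
open import Data.Bool using (if_then_else_; _∧_)
open import Data.Maybe using (just)
open import Data.Product using (∃; _×_; _,_; proj₁; proj₂)
open import Data.Sum using (_⊎_; inj₁; inj₂)
open import Data.Empty using (⊥-elim)
open import Relation.Nullary using (¬_; Dec; yes; no; does)
open import Relation.Nullary.Decidable using (decidable-stable; ¬¬-excluded-middle)
open import Relation.Binary.PropositionalEquality
  using (_≡_; _≢_; refl; cong; cong₂; sym; trans; subst; subst₂; module ≡-Reasoning)
open import Algebra.Structures using (IsCommutativeRing)
open import Level using (0ℓ)
open import Relation.Binary.Bundles using (Setoid)
import Relation.Binary.Reasoning.Setoid as SetoidReasoning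
open import Algebra.Properties.CommutativeSemigroup ℕₚ.+-commutativeSemigroup using (interchange)

private
  variable
    X Y : Set

-- Finite sums over lists

sumOf : (X → ℕ) → List X → ℕ
sumOf φ xs = sum (map φ xs)

sumOf-++ : (φ : X → ℕ) (xs ys : List X) → sumOf φ (xs ++ ys) ≡ sumOf φ xs ℕ.+ sumOf φ ys
sumOf-++ φ xs ys = trans (cong sum (Listₚ.map-++ φ xs ys)) (sum-++ (map φ xs) (map φ ys))

sumOf-concatMap : (φ : Y → ℕ) (g : X → List Y) (xs : List X) →
                  sumOf φ (concatMap g xs) ≡ sumOf (λ x → sumOf φ (g x)) xs
sumOf-concatMap φ g [] = refl
sumOf-concatMap φ g (x ∷ xs) =
  trans (sumOf-++ φ (g x) (concatMap g xs)) (cong (sumOf φ (g x) ℕ.+_) (sumOf-concatMap φ g xs))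

sumOf-map : (φ : Y → ℕ) (f : X → Y) (xs : List X) → sumOf φ (map f xs) ≡ sumOf (λ x → φ (f x)) xs
sumOf-map φ f [] = refl
sumOf-map φ f (x ∷ xs) = cong (φ (f x) ℕ.+_) (sumOf-map φ f xs)

sumOf-cong : {φ ψ : X → ℕ} → (∀ x → φ x ≡ ψ x) → (xs : List X) → sumOf φ xs ≡ sumOf ψ xs
sumOf-cong e [] = refl
sumOf-cong e (x ∷ xs) = cong₂ ℕ._+_ (e x) (sumOf-cong e xs)

sumOf-vanishing : {φ : X → ℕ} {xs : List X} → All (λ x → φ x ≡ 0) xs → sumOf φ xs ≡ 0
sumOf-vanishing All.[] = refl
sumOf-vanishing (φx≡0 All.∷ rest) = cong₂ ℕ._+_ φx≡0 (sumOf-vanishing rest)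

sumOf-zero : (xs : List X) → sumOf (λ _ → 0) xs ≡ 0
sumOf-zero xs = sumOf-vanishing (All.universal (λ _ → refl) xs)

sumOf-+ : (φ ψ : X → ℕ) (xs : List X) → sumOf (λ x → φ x ℕ.+ ψ x) xs ≡ sumOf φ xs ℕ.+ sumOf ψ xs
sumOf-+ φ ψ [] = refl
sumOf-+ φ ψ (x ∷ xs) =
  trans (cong (φ x ℕ.+ ψ x ℕ.+_) (sumOf-+ φ ψ xs)) (interchange (φ x) (ψ x) (sumOf φ xs) (sumOf ψ xs))

sumOf-swap : (f : X → Y → ℕ) (xs : List X) (ys : List Y) →
             sumOf (λ x → sumOf (f x) ys) xs ≡ sumOf (λ y → sumOf (λ x → f x y) xs) ys
sumOf-swap f [] ys = sym (sumOf-zero ys)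
sumOf-swap f (x ∷ xs) ys =
  trans (cong (sumOf (f x) ys ℕ.+_) (sumOf-swap f xs ys))
        (sym (sumOf-+ (f x) (λ y → sumOf (λ x' → f x' y) xs) ys))

sumOf-point : (φ : X → ℕ) {xs : List X} {a : X} → AllPairs _≢_ xs → a ∈ xs →
              (∀ x → x ≢ a → φ x ≡ 0) → sumOf φ xs ≡ φ a
sumOf-point φ (distinct AllPairs.∷ _) (here refl) off =
  trans (cong (φ _ ℕ.+_) (sumOf-vanishing (All.map (λ a≢y → off _ (λ y≡a → a≢y (sym y≡a))) distinct)))
        (ℕₚ.+-identityʳ _)
sumOf-point φ {x ∷ xs} (distinct AllPairs.∷ unique) (there a∈xs) off =
  trans (cong (ℕ._+ sumOf φ xs) (off x (All.lookup distinct a∈xs))) (sumOf-point φ unique a∈xs off)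

-- Guarded summands: the summand of Ψ̃ has the shape  if P ∧ D then x else 0,
-- the summand of ν the shape  if Z then 0 else x.

guarded-off : {P D : Set} (p : Dec P) (d : Dec D) (x : ℕ) → ¬ D → (if does p ∧ does d then x else 0) ≡ 0
guarded-off (yes _) (yes d) x ¬d = ⊥-elim (¬d d)
guarded-off (yes _) (no _) x _ = refl
guarded-off (no _) _ x _ = refl

guarded-switch : {P D Z : Set} (p : Dec P) (d : Dec D) (z : Dec Z) (x : ℕ) → D → (Z → ¬ P) → (¬ Z → P) →
                 (if does p ∧ does d then x else 0) ≡ (if does z then 0 else x)
guarded-switch p (no ¬d) z x d _ _ = ⊥-elim (¬d d)
guarded-switch (yes holds) (yes _) (yes z) x _ z⇒¬p _ = ⊥-elim (z⇒¬p z holds)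
guarded-switch (no _) (yes _) (yes _) x _ _ _ = refl
guarded-switch (yes _) (yes _) (no _) x _ _ _ = refl
guarded-switch (no ¬p) (yes _) (no ¬z) x _ _ ¬z⇒p = ⊥-elim (¬p (¬z⇒p ¬z))

module PolynomialTheory (𝔽 : FiniteField) where
  open FiniteField 𝔽
  open Poly 𝔽
  open IsCommutativeRing isCommutativeRing
    using (+-identityˡ; +-identityʳ; +-comm; +-assoc; *-comm; *-assoc; *-identityˡ;
           distribˡ; distribʳ; zeroˡ; zeroʳ; -‿inverseˡ; -‿inverseʳ)

  1≢0 : 1# ≢ 0#
  1≢0 1≡0 = 0≢1 (sym 1≡0)

  *-nonzero : ∀ {x y} → x ≢ 0# → y ≢ 0# → x * y ≢ 0#
  *-nonzero {x} {y} x≢0 y≢0 xy≡0 with inverse x x≢0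
  ... | x⁻¹ , xx⁻¹≡1 = y≢0 (begin
    y              ≡⟨ sym (*-identityˡ y) ⟩
    1# * y         ≡⟨ cong (λ t → t * y) (trans (sym xx⁻¹≡1) (*-comm x x⁻¹)) ⟩
    x⁻¹ * x * y    ≡⟨ *-assoc x⁻¹ x y ⟩
    x⁻¹ * (x * y)  ≡⟨ cong (x⁻¹ *_) xy≡0 ⟩
    x⁻¹ * 0#       ≡⟨ zeroʳ x⁻¹ ⟩
    0#             ∎)
    where open ≡-Reasoning

  power : F → ℕ → F
  power x zero = 1#
  power x (suc k) = x * power x k

  power-nonzero : ∀ x k → x ≢ 0# → power x k ≢ 0#
  power-nonzero x zero _ = 1≢0
  power-nonzero x (suc k) x≢0 = *-nonzero x≢0 (power-nonzero x k x≢0)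

  power-nonzero⁻¹ : ∀ x k → 1 ≤ k → power x k ≢ 0# → x ≢ 0#
  power-nonzero⁻¹ x (suc k) _ xᵏ≢0 x≡0 =
    xᵏ≢0 (trans (cong (λ t → t * power x k) x≡0) (zeroˡ (power x k)))

  -- Equality of coefficient lists up to trailing zeros.  This inductive
  -- relation coincides with  p ≈ q  (equal normalisations) but can be
  -- reasoned about by structural induction.

  infix 4 _∼_
  data _∼_ : Pol → Pol → Set where
    nil    : [] ∼ []
    []∼0∷  : ∀ {y ys} → y ≡ 0# → [] ∼ ys → [] ∼ (y ∷ ys)
    0∷∼[]  : ∀ {x xs} → x ≡ 0# → xs ∼ [] → (x ∷ xs) ∼ []
    cons   : ∀ {x y xs ys} → x ≡ y → xs ∼ ys → (x ∷ xs) ∼ (y ∷ ys)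

  ∼-refl : ∀ {p} → p ∼ p
  ∼-refl {[]} = nil
  ∼-refl {x ∷ xs} = cons refl ∼-refl

  ≡⇒∼ : ∀ {p q} → p ≡ q → p ∼ q
  ≡⇒∼ refl = ∼-refl

  ∼-sym : ∀ {p q} → p ∼ q → q ∼ p
  ∼-sym nil = nil
  ∼-sym ([]∼0∷ e r) = 0∷∼[] e (∼-sym r)
  ∼-sym (0∷∼[] e r) = []∼0∷ e (∼-sym r)
  ∼-sym (cons e r) = cons (sym e) (∼-sym r)

  ∼-trans : ∀ {p q r} → p ∼ q → q ∼ r → p ∼ r
  ∼-trans nil s = s
  ∼-trans ([]∼0∷ e r) (0∷∼[] f s) = nil
  ∼-trans ([]∼0∷ e r) (cons f s) = []∼0∷ (trans (sym f) e) (∼-trans r s)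
  ∼-trans (0∷∼[] e r) nil = 0∷∼[] e r
  ∼-trans (0∷∼[] e r) ([]∼0∷ f s) = cons (trans e (sym f)) (∼-trans r s)
  ∼-trans (cons e r) (0∷∼[] f s) = 0∷∼[] (trans e f) (∼-trans r s)
  ∼-trans (cons e r) (cons f s) = cons (trans e f) (∼-trans r s)

  ∼-setoid : Setoid 0ℓ 0ℓ
  ∼-setoid = record
    { Carrier = Pol ; _≈_ = _∼_
    ; isEquivalence = record { refl = ∼-refl ; sym = ∼-sym ; trans = ∼-trans } }

  module ∼-Reasoning = SetoidReasoning ∼-setoid

  normCons : F → Pol → Pol
  normCons x [] = if does (x ≟ 0#) then [] else x ∷ []
  normCons x (y ∷ ys) = x ∷ y ∷ ys

  norm-∷ : ∀ x xs → norm (x ∷ xs) ≡ normCons x (norm xs)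
  norm-∷ x xs with norm xs
  ... | [] = refl
  ... | y ∷ ys = refl

  normCons-zero : ∀ {x} → x ≡ 0# → normCons x [] ≡ []
  normCons-zero {x} x≡0 with x ≟ 0#
  ... | yes _ = refl
  ... | no x≢0 = ⊥-elim (x≢0 x≡0)

  normCons-nonzero : ∀ {x} → x ≢ 0# → normCons x [] ≡ x ∷ []
  normCons-nonzero {x} x≢0 with x ≟ 0#
  ... | yes x≡0 = ⊥-elim (x≢0 x≡0)
  ... | no _ = refl

  ∼⇒≈ : ∀ {p q} → p ∼ q → p ≈ q
  ∼⇒≈ nil = refl
  ∼⇒≈ {q = y ∷ ys} ([]∼0∷ e r) =
    sym (trans (norm-∷ y ys) (trans (cong (normCons y) (sym (∼⇒≈ r))) (normCons-zero e)))
  ∼⇒≈ {p = x ∷ xs} (0∷∼[] e r) = trans (norm-∷ x xs) (trans (cong (normCons x) (∼⇒≈ r)) (normCons-zero e))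
  ∼⇒≈ {x ∷ xs} {y ∷ ys} (cons e r) =
    trans (norm-∷ x xs) (trans (cong₂ normCons e (∼⇒≈ r)) (sym (norm-∷ y ys)))

  ∼-normCons : ∀ x {xs} n → xs ∼ n → (x ∷ xs) ∼ normCons x n
  ∼-normCons x [] r with x ≟ 0#
  ... | yes x≡0 = 0∷∼[] x≡0 r
  ... | no _ = cons refl r
  ∼-normCons x (y ∷ ys) r = cons refl r

  ∼-norm : ∀ p → p ∼ norm p
  ∼-norm [] = nil
  ∼-norm (x ∷ xs) = subst ((x ∷ xs) ∼_) (sym (norm-∷ x xs)) (∼-normCons x (norm xs) (∼-norm xs))

  ∼-norm′ : ∀ p {n} → norm p ≡ n → p ∼ n
  ∼-norm′ p refl = ∼-norm p

  ≈⇒∼ : ∀ p q → p ≈ q → p ∼ q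
  ≈⇒∼ p q e = ∼-trans (∼-norm′ p e) (∼-sym (∼-norm q))

  -- Ring laws for ⊕, scale and ⊗ (up to trailing zeros)

  ⊕-identityʳ : ∀ p → p ⊕ [] ≡ p
  ⊕-identityʳ [] = refl
  ⊕-identityʳ (x ∷ xs) = refl

  ⊕-comm : ∀ p q → p ⊕ q ≡ q ⊕ p
  ⊕-comm [] q = sym (⊕-identityʳ q)
  ⊕-comm (x ∷ xs) [] = refl
  ⊕-comm (x ∷ xs) (y ∷ ys) = cong₂ _∷_ (+-comm x y) (⊕-comm xs ys)

  ⊕-assoc : ∀ p q r → (p ⊕ q) ⊕ r ≡ p ⊕ (q ⊕ r)
  ⊕-assoc [] q r = refl
  ⊕-assoc (x ∷ xs) [] r = refl
  ⊕-assoc (x ∷ xs) (y ∷ ys) [] = refl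
  ⊕-assoc (x ∷ xs) (y ∷ ys) (z ∷ zs) = cong₂ _∷_ (+-assoc x y z) (⊕-assoc xs ys zs)

  ⊕-interchange : ∀ a b c d → (a ⊕ b) ⊕ (c ⊕ d) ≡ (a ⊕ c) ⊕ (b ⊕ d)
  ⊕-interchange a b c d = begin
    (a ⊕ b) ⊕ (c ⊕ d)  ≡⟨ ⊕-assoc a b (c ⊕ d) ⟩
    a ⊕ (b ⊕ (c ⊕ d))  ≡⟨ cong (a ⊕_) (sym (⊕-assoc b c d)) ⟩
    a ⊕ ((b ⊕ c) ⊕ d)  ≡⟨ cong (λ t → a ⊕ (t ⊕ d)) (⊕-comm b c) ⟩
    a ⊕ ((c ⊕ b) ⊕ d)  ≡⟨ cong (a ⊕_) (⊕-assoc c b d) ⟩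
    a ⊕ (c ⊕ (b ⊕ d))  ≡⟨ sym (⊕-assoc a c (b ⊕ d)) ⟩
    (a ⊕ c) ⊕ (b ⊕ d)  ∎
    where open ≡-Reasoning

  ⊕-congˡ : ∀ {p p′} q → p ∼ p′ → p ⊕ q ∼ p′ ⊕ q
  ⊕-congˡ q nil = ∼-refl
  ⊕-congˡ [] ([]∼0∷ e r) = []∼0∷ e r
  ⊕-congˡ (y ∷ ys) ([]∼0∷ e r) = cons (sym (trans (cong (_+ y) e) (+-identityˡ y))) (⊕-congˡ ys r)
  ⊕-congˡ [] (0∷∼[] e r) = 0∷∼[] e r
  ⊕-congˡ (y ∷ ys) (0∷∼[] e r) = cons (trans (cong (_+ y) e) (+-identityˡ y)) (⊕-congˡ ys r)
  ⊕-congˡ [] (cons e r) = cons e r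
  ⊕-congˡ (y ∷ ys) (cons e r) = cons (cong (_+ y) e) (⊕-congˡ ys r)

  ⊕-congʳ : ∀ p {q q′} → q ∼ q′ → p ⊕ q ∼ p ⊕ q′
  ⊕-congʳ p {q} {q′} q∼q′ =
    subst₂ _∼_ (⊕-comm q p) (⊕-comm q′ p) (⊕-congˡ p q∼q′)

  ⊕-cong : ∀ {p p′ q q′} → p ∼ p′ → q ∼ q′ → p ⊕ q ∼ p′ ⊕ q′
  ⊕-cong {p′ = p′} {q = q} p∼p′ q∼q′ = ∼-trans (⊕-congˡ q p∼p′) (⊕-congʳ p′ q∼q′)

  scale-cong : ∀ c {p q} → p ∼ q → scale c p ∼ scale c q
  scale-cong c nil = nil
  scale-cong c ([]∼0∷ e r) = []∼0∷ (trans (cong (c *_) e) (zeroʳ c)) (scale-cong c r)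
  scale-cong c (0∷∼[] e r) = 0∷∼[] (trans (cong (c *_) e) (zeroʳ c)) (scale-cong c r)
  scale-cong c (cons e r) = cons (cong (c *_) e) (scale-cong c r)

  scale-by-zero : ∀ {c} p → c ≡ 0# → scale c p ∼ []
  scale-by-zero [] c≡0 = nil
  scale-by-zero (x ∷ xs) c≡0 = 0∷∼[] (trans (cong (λ t → t * x) c≡0) (zeroˡ x)) (scale-by-zero xs c≡0)

  scale-⊕ : ∀ c p q → scale c (p ⊕ q) ≡ scale c p ⊕ scale c q
  scale-⊕ c [] q = refl
  scale-⊕ c (x ∷ xs) [] = refl
  scale-⊕ c (x ∷ xs) (y ∷ ys) = cong₂ _∷_ (distribˡ c x y) (scale-⊕ c xs ys)

  scale-+ : ∀ c d p → scale (c + d) p ≡ scale c p ⊕ scale d p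
  scale-+ c d [] = refl
  scale-+ c d (x ∷ xs) = cong₂ _∷_ (distribʳ x c d) (scale-+ c d xs)

  scale-scale : ∀ c d p → scale c (scale d p) ≡ scale (c * d) p
  scale-scale c d [] = refl
  scale-scale c d (x ∷ xs) = cong₂ _∷_ (sym (*-assoc c d x)) (scale-scale c d xs)

  scale-1 : ∀ p → scale 1# p ≡ p
  scale-1 [] = refl
  scale-1 (x ∷ xs) = cong₂ _∷_ (*-identityˡ x) (scale-1 xs)

  scale-inverse : ∀ {c d} p → c * d ≡ 1# → scale c (scale d p) ≡ p
  scale-inverse {c} {d} p cd≡1 = trans (scale-scale c d p) (trans (cong (λ t → scale t p) cd≡1) (scale-1 p))

  length-scale : ∀ c p → length (scale c p) ≡ length p
  length-scale c = Listₚ.length-map (c *_)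

  ⊗-congˡ : ∀ {p p′} q → p ∼ p′ → p ⊗ q ∼ p′ ⊗ q
  ⊗-congˡ q nil = nil
  ⊗-congˡ q ([]∼0∷ e r) = ∼-sym (⊕-cong (scale-by-zero q e) (0∷∼[] refl (∼-sym (⊗-congˡ q r))))
  ⊗-congˡ q (0∷∼[] e r) = ⊕-cong (scale-by-zero q e) (0∷∼[] refl (⊗-congˡ q r))
  ⊗-congˡ q (cons {y = y} refl r) = ⊕-congʳ (scale y q) (cons refl (⊗-congˡ q r))

  ⊗-congʳ : ∀ p {q q′} → q ∼ q′ → p ⊗ q ∼ p ⊗ q′
  ⊗-congʳ [] q∼q′ = nil
  ⊗-congʳ (x ∷ xs) q∼q′ = ⊕-cong (scale-cong x q∼q′) (cons refl (⊗-congʳ xs q∼q′))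

  ⊗-cong : ∀ {p p′ q q′} → p ∼ p′ → q ∼ q′ → p ⊗ q ∼ p′ ⊗ q′
  ⊗-cong {p′ = p′} {q = q} p∼p′ q∼q′ = ∼-trans (⊗-congˡ q p∼p′) (⊗-congʳ p′ q∼q′)

  ⊗-zeroʳ : ∀ p → p ⊗ [] ∼ []
  ⊗-zeroʳ [] = nil
  ⊗-zeroʳ (x ∷ xs) = 0∷∼[] refl (⊗-zeroʳ xs)

  ⊗-distribʳ : ∀ p q r → (p ⊕ q) ⊗ r ∼ p ⊗ r ⊕ q ⊗ r
  ⊗-distribʳ [] q r = ∼-refl
  ⊗-distribʳ (x ∷ xs) [] r = ≡⇒∼ (sym (⊕-identityʳ _))
  ⊗-distribʳ (x ∷ xs) (y ∷ ys) r = begin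
    scale (x + y) r ⊕ (0# ∷ (xs ⊕ ys) ⊗ r)
      ≈⟨ ⊕-cong (≡⇒∼ (scale-+ x y r)) (cons refl (⊗-distribʳ xs ys r)) ⟩
    (scale x r ⊕ scale y r) ⊕ (0# ∷ (xs ⊗ r ⊕ ys ⊗ r))
      ≈⟨ ⊕-congʳ (scale x r ⊕ scale y r) (cons (sym (+-identityˡ 0#)) ∼-refl) ⟩
    (scale x r ⊕ scale y r) ⊕ ((0# ∷ xs ⊗ r) ⊕ (0# ∷ ys ⊗ r))
      ≡⟨ ⊕-interchange (scale x r) (scale y r) (0# ∷ xs ⊗ r) (0# ∷ ys ⊗ r) ⟩
    (scale x r ⊕ (0# ∷ xs ⊗ r)) ⊕ (scale y r ⊕ (0# ∷ ys ⊗ r)) ∎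
    where open ∼-Reasoning

  scale-⊗ˡ : ∀ c p q → scale c (p ⊗ q) ∼ scale c p ⊗ q
  scale-⊗ˡ c [] q = nil
  scale-⊗ˡ c (x ∷ xs) q = begin
    scale c (scale x q ⊕ (0# ∷ xs ⊗ q))
      ≡⟨ trans (scale-⊕ c (scale x q) (0# ∷ xs ⊗ q)) (cong (_⊕ _) (scale-scale c x q)) ⟩
    scale (c * x) q ⊕ (c * 0# ∷ scale c (xs ⊗ q))
      ≈⟨ ⊕-congʳ (scale (c * x) q) (cons (zeroʳ c) (scale-⊗ˡ c xs q)) ⟩
    scale (c * x) q ⊕ (0# ∷ scale c xs ⊗ q) ∎
    where open ∼-Reasoning

  scale-⊗ʳ : ∀ c p q → scale c (p ⊗ q) ∼ p ⊗ scale c q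
  scale-⊗ʳ c [] q = nil
  scale-⊗ʳ c (x ∷ xs) q = begin
    scale c (scale x q ⊕ (0# ∷ xs ⊗ q))
      ≡⟨ trans (scale-⊕ c (scale x q) (0# ∷ xs ⊗ q)) (cong (_⊕ _) swap) ⟩
    scale x (scale c q) ⊕ (c * 0# ∷ scale c (xs ⊗ q))
      ≈⟨ ⊕-congʳ (scale x (scale c q)) (cons (zeroʳ c) (scale-⊗ʳ c xs q)) ⟩
    scale x (scale c q) ⊕ (0# ∷ xs ⊗ scale c q) ∎
    where
      open ∼-Reasoning
      swap : scale c (scale x q) ≡ scale x (scale c q)
      swap = trans (scale-scale c x q) (trans (cong (λ t → scale t q) (*-comm c x)) (sym (scale-scale x c q)))

  const-⊗ : ∀ c p → (c ∷ []) ⊗ p ∼ scale c p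
  const-⊗ c p = ∼-trans (⊕-congʳ (scale c p) (0∷∼[] refl nil)) (≡⇒∼ (⊕-identityʳ _))

  shift : ℕ → Pol → Pol
  shift k p = replicate k 0# ++ p

  shift-cong : ∀ k {p q} → p ∼ q → shift k p ∼ shift k q
  shift-cong zero p∼q = p∼q
  shift-cong (suc k) p∼q = cons refl (shift-cong k p∼q)

  shift-⊗ : ∀ k p q → shift k p ⊗ q ∼ shift k (p ⊗ q)
  shift-⊗ zero p q = ∼-refl
  shift-⊗ (suc k) p q =
    ∼-trans (⊕-congˡ (0# ∷ shift k p ⊗ q) (scale-by-zero q refl)) (cons refl (shift-⊗ k p q))

  Tpow-⊗ : ∀ k p → Tpow k ⊗ p ∼ shift k p
  Tpow-⊗ k p = ∼-trans (shift-⊗ k (1# ∷ []) p) (shift-cong k (∼-trans (const-⊗ 1# p) (≡⇒∼ (scale-1 p))))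

  zeros∼[] : ∀ k → replicate k 0# ∼ []
  zeros∼[] zero = nil
  zeros∼[] (suc k) = 0∷∼[] refl (zeros∼[] k)

  ++-as-⊕ : ∀ p q → p ++ q ≡ p ⊕ shift (length p) q
  ++-as-⊕ [] q = refl
  ++-as-⊕ (x ∷ p) q = cong₂ _∷_ (sym (+-identityʳ x)) (++-as-⊕ p q)

  -- the last entry of a coefficient list (0 for the empty list)
  lead : Pol → F
  lead [] = 0#
  lead (x ∷ []) = x
  lead (x ∷ y ∷ ys) = lead (y ∷ ys)

  norm-normal : ∀ p → lead p ≢ 0# → norm p ≡ p
  norm-normal [] lead≢0 = ⊥-elim (lead≢0 refl)
  norm-normal (x ∷ []) lead≢0 = normCons-nonzero lead≢0
  norm-normal (x ∷ y ∷ ys) lead≢0 = trans (norm-∷ x (y ∷ ys)) (cong (normCons x) (norm-normal (y ∷ ys) lead≢0))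

  norm-zero-or-normal : ∀ p → norm p ≡ [] ⊎ lead (norm p) ≢ 0#
  norm-zero-or-normal [] = inj₁ refl
  norm-zero-or-normal (x ∷ xs) =
    subst (λ n → n ≡ [] ⊎ lead n ≢ 0#) (sym (norm-∷ x xs)) (normCons-shape (norm xs) (norm-zero-or-normal xs))
    where
      normCons-shape : ∀ n → n ≡ [] ⊎ lead n ≢ 0# → normCons x n ≡ [] ⊎ lead (normCons x n) ≢ 0#
      normCons-shape [] _ with x ≟ 0#
      ... | yes _ = inj₁ refl
      ... | no x≢0 = inj₂ x≢0
      normCons-shape (y ∷ ys) (inj₂ lead≢0) = inj₂ lead≢0

  length-norm-lead≡0 : ∀ p → lead p ≡ 0# → length (norm p) ≤ ℕ.pred (length p)
  length-norm-lead≡0 [] _ = z≤n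
  length-norm-lead≡0 (x ∷ []) x≡0 = subst (λ n → length n ≤ 0) (sym (normCons-zero x≡0)) z≤n
  length-norm-lead≡0 (x ∷ y ∷ ys) lead≡0 =
    subst (λ n → length n ≤ suc (length ys)) (sym (norm-∷ x (y ∷ ys)))
      (ℕₚ.≤-trans (length-normCons (norm (y ∷ ys))) (s≤s (length-norm-lead≡0 (y ∷ ys) lead≡0)))
    where
      length-normCons : ∀ n → length (normCons x n) ≤ suc (length n)
      length-normCons [] with x ≟ 0#
      ... | yes _ = z≤n
      ... | no _ = s≤s z≤n
      length-normCons (_ ∷ _) = ℕₚ.≤-refl

  lead-++ : ∀ p {q} → 0 < length q → lead (p ++ q) ≡ lead q
  lead-++ [] _ = refl
  lead-++ (x ∷ []) {_ ∷ _} _ = refl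
  lead-++ (x ∷ z ∷ p) 0<|q| = lead-++ (z ∷ p) 0<|q|

  lead-scale : ∀ c p → lead (scale c p) ≡ c * lead p
  lead-scale c [] = sym (zeroʳ c)
  lead-scale c (x ∷ []) = refl
  lead-scale c (x ∷ y ∷ ys) = lead-scale c (y ∷ ys)

  lead-reverse : ∀ p → lead (reverse p) ≡ coeff0 p
  lead-reverse [] = refl
  lead-reverse (x ∷ p) = trans (cong lead (Listₚ.unfold-reverse x p)) (lead-++ (reverse p) (s≤s z≤n))

  coeff0-reverse : ∀ p → coeff0 (reverse p) ≡ lead p
  coeff0-reverse p = trans (sym (lead-reverse (reverse p))) (cong lead (Listₚ.reverse-involutive p))

  last-lead : ∀ p → lead p ≢ 0# → last p ≡ just (lead p)
  last-lead [] lead≢0 = ⊥-elim (lead≢0 refl)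
  last-lead (x ∷ []) _ = refl
  last-lead (x ∷ y ∷ ys) lead≢0 = last-lead (y ∷ ys) lead≢0

  coeff0-∼ : ∀ {p q} → p ∼ q → coeff0 p ≡ coeff0 q
  coeff0-∼ nil = refl
  coeff0-∼ ([]∼0∷ e _) = sym e
  coeff0-∼ (0∷∼[] e _) = e
  coeff0-∼ (cons e _) = e

  coeff0-scale : ∀ c p → coeff0 (scale c p) ≡ c * coeff0 p
  coeff0-scale c [] = sym (zeroʳ c)
  coeff0-scale c (x ∷ p) = refl

  coeff0-⊗ : ∀ p q → coeff0 (p ⊗ q) ≡ coeff0 p * coeff0 q
  coeff0-⊗ [] q = sym (zeroˡ (coeff0 q))
  coeff0-⊗ (x ∷ xs) [] = sym (zeroʳ x)
  coeff0-⊗ (x ∷ xs) (y ∷ ys) = +-identityʳ (x * y)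

  length-⊕ : ∀ p q → length (p ⊕ q) ≡ length p ⊔ length q
  length-⊕ [] q = refl
  length-⊕ (x ∷ xs) [] = refl
  length-⊕ (x ∷ xs) (y ∷ ys) = cong suc (length-⊕ xs ys)

  length-⊗ : ∀ p q → length (p ⊗ q) ≤ length p ℕ.+ ℕ.pred (length q)
  length-⊗ [] q = z≤n
  length-⊗ (x ∷ xs) q =
    subst (_≤ bound) (sym (length-⊕ (scale x q) (0# ∷ xs ⊗ q)))
      (ℕₚ.⊔-lub (subst (_≤ bound) (sym (length-scale x q)) (length-q q)) (s≤s (length-⊗ xs q)))
    where
      bound = suc (length xs ℕ.+ ℕ.pred (length q))
      length-q : ∀ r → length r ≤ suc (length xs ℕ.+ ℕ.pred (length r))
      length-q [] = z≤n
      length-q (_ ∷ r) = s≤s (ℕₚ.m≤n+m (length r) (length xs))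

  ⊕-shorter : ∀ p q → length p < length q → lead (p ⊕ q) ≡ lead q × length (p ⊕ q) ≡ length q
  ⊕-shorter [] q _ = refl , refl
  ⊕-shorter (x ∷ []) (y ∷ z ∷ zs) _ = refl , refl
  ⊕-shorter (x ∷ x′ ∷ xs) (y ∷ z ∷ zs) (s≤s lt) with ⊕-shorter (x′ ∷ xs) (z ∷ zs) lt
  ... | same-lead , same-length = same-lead , cong suc same-length
  ⊕-shorter (x ∷ _) (y ∷ []) (s≤s ())

  lead-∷ : ∀ c r → 0 < length r → lead (c ∷ r) ≡ lead r
  lead-∷ c (_ ∷ _) _ = refl

  ⊗-lead : ∀ P Q → lead P ≢ 0# → lead Q ≢ 0# →
           lead (P ⊗ Q) ≡ lead P * lead Q × suc (length (P ⊗ Q)) ≡ length P ℕ.+ length Q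
  ⊗-lead [] Q P≢0 _ = ⊥-elim (P≢0 refl)
  ⊗-lead P [] _ Q≢0 = ⊥-elim (Q≢0 refl)
  ⊗-lead (x ∷ []) (q ∷ []) _ _ = +-identityʳ (x * q) , refl
  ⊗-lead (x ∷ []) (q ∷ q′ ∷ qs) _ _ =
    lead-scale x (q′ ∷ qs) , cong (λ t → suc (suc (suc t))) (length-scale x qs)
  ⊗-lead (x ∷ x′ ∷ xs) Q@(q ∷ qs) P≢0 Q≢0 with ⊗-lead (x′ ∷ xs) Q P≢0 Q≢0
  ... | lead-R , length-R =
    trans (proj₁ absorbed) (trans (lead-∷ 0# R R-nonempty) lead-R) , cong suc (trans (proj₂ absorbed) length-R)
    where
      R = (x′ ∷ xs) ⊗ Q
      shorter : length (scale x Q) < length (0# ∷ R)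
      shorter = s≤s (subst₂ _≤_ (sym (length-scale x Q)) (ℕₚ.suc-injective (sym length-R))
                               (ℕₚ.m≤n+m (length Q) (length xs)))
      absorbed = ⊕-shorter (scale x Q) (0# ∷ R) shorter
      R-nonempty : 0 < length R
      R-nonempty = subst (0 <_) (sym (trans (ℕₚ.suc-injective length-R) (ℕₚ.+-suc (length xs) (length qs))))
                         (s≤s z≤n)

  -- The induction runs on the padded reversal  revPad n p = T^{n-1} p(1/T)
  -- (p viewed as a list of n coefficients), which is additive and satisfies
  -- revPad (a + b) (p ⊗ q) ∼ revPad a p ⊗ revPad (b + 1) q  whenever |p| ≤ a, |q| ≤ b + 1.

  padTo : ℕ → Pol → Pol
  padTo n p = p ++ replicate (n ∸ length p) 0#

  revPad : ℕ → Pol → Pol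
  revPad n p = reverse (padTo n p)

  length-padTo : ∀ n p → length p ≤ n → length (padTo n p) ≡ n
  length-padTo n p |p|≤n = begin
    length (p ++ replicate (n ∸ length p) 0#)     ≡⟨ Listₚ.length-++ p ⟩
    length p ℕ.+ length (replicate (n ∸ length p) 0#) ≡⟨ cong (length p ℕ.+_) (Listₚ.length-replicate (n ∸ length p)) ⟩
    length p ℕ.+ (n ∸ length p)                   ≡⟨ ℕₚ.+-comm (length p) (n ∸ length p) ⟩
    n ∸ length p ℕ.+ length p                     ≡⟨ ℕₚ.m∸n+n≡m |p|≤n ⟩
    n                                             ∎
    where open ≡-Reasoning

  length-revPad : ∀ n p → length p ≤ n → length (revPad n p) ≡ n
  length-revPad n p |p|≤n = trans (Listₚ.length-reverse (padTo n p)) (length-padTo n p |p|≤n)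

  revPad-full : ∀ p → revPad (length p) p ≡ reverse p
  revPad-full p = cong reverse (trans (cong (λ k → p ++ replicate k 0#) (ℕₚ.n∸n≡0 (length p))) (Listₚ.++-identityʳ p))

  zeros-⊕ : ∀ k p → k ≤ length p → replicate k 0# ⊕ p ≡ p
  zeros-⊕ zero p _ = refl
  zeros-⊕ (suc k) (y ∷ ys) (s≤s k≤) = cong₂ _∷_ (+-identityˡ y) (zeros-⊕ k ys k≤)

  padTo-⊕ : ∀ n p q → length p ≤ n → length q ≤ n → padTo n (p ⊕ q) ≡ padTo n p ⊕ padTo n q
  padTo-⊕ n [] q _ |q|≤n = sym (zeros-⊕ n (padTo n q) (ℕₚ.≤-reflexive (sym (length-padTo n q |q|≤n))))
  padTo-⊕ n p@(_ ∷ _) [] |p|≤n _ =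
    sym (trans (⊕-comm (padTo n p) (replicate n 0#)) (zeros-⊕ n (padTo n p) (ℕₚ.≤-reflexive (sym (length-padTo n p |p|≤n)))))
  padTo-⊕ (suc n) (x ∷ xs) (y ∷ ys) (s≤s |xs|≤n) (s≤s |ys|≤n) = cong ((x + y) ∷_) (padTo-⊕ n xs ys |xs|≤n |ys|≤n)

  ++-⊕ : ∀ s t g k → length s ≡ length t → (s ++ g) ⊕ (t ++ k) ≡ (s ⊕ t) ++ (g ⊕ k)
  ++-⊕ [] [] g k _ = refl
  ++-⊕ (x ∷ s) (y ∷ t) g k |s|≡|t| = cong ((x + y) ∷_) (++-⊕ s t g k (ℕₚ.suc-injective |s|≡|t|))

  reverse-⊕ : ∀ p q → length p ≡ length q → reverse (p ⊕ q) ≡ reverse p ⊕ reverse q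
  reverse-⊕ [] [] _ = refl
  reverse-⊕ (x ∷ p) (y ∷ q) |p|≡|q| = begin
    reverse ((x + y) ∷ (p ⊕ q))                     ≡⟨ Listₚ.unfold-reverse (x + y) (p ⊕ q) ⟩
    reverse (p ⊕ q) ++ (x + y) ∷ []                 ≡⟨ cong (_++ (x + y) ∷ []) (reverse-⊕ p q (ℕₚ.suc-injective |p|≡|q|)) ⟩
    (reverse p ⊕ reverse q) ++ ((x ∷ []) ⊕ (y ∷ [])) ≡⟨ sym (++-⊕ (reverse p) (reverse q) (x ∷ []) (y ∷ []) same-length) ⟩
    (reverse p ++ x ∷ []) ⊕ (reverse q ++ y ∷ [])   ≡⟨ sym (cong₂ _⊕_ (Listₚ.unfold-reverse x p) (Listₚ.unfold-reverse y q)) ⟩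
    reverse (x ∷ p) ⊕ reverse (y ∷ q)               ∎
    where
      open ≡-Reasoning
      same-length : length (reverse p) ≡ length (reverse q)
      same-length = trans (Listₚ.length-reverse p) (trans (ℕₚ.suc-injective |p|≡|q|) (sym (Listₚ.length-reverse q)))

  revPad-⊕ : ∀ n p q → length p ≤ n → length q ≤ n → revPad n (p ⊕ q) ≡ revPad n p ⊕ revPad n q
  revPad-⊕ n p q |p|≤n |q|≤n =
    trans (cong reverse (padTo-⊕ n p q |p|≤n |q|≤n))
          (reverse-⊕ (padTo n p) (padTo n q) (trans (length-padTo n p |p|≤n) (sym (length-padTo n q |q|≤n))))

  revPad-∷ : ∀ n x p → revPad (suc n) (x ∷ p) ≡ revPad n p ++ x ∷ []
  revPad-∷ n x p = Listₚ.unfold-reverse x (padTo n p)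

  replicate-+ : ∀ a b (x : F) → replicate (a ℕ.+ b) x ≡ replicate a x ++ replicate b x
  replicate-+ zero b x = refl
  replicate-+ (suc a) b x = cong (x ∷_) (replicate-+ a b x)

  reverse-zeros : ∀ k → reverse (replicate k 0#) ≡ replicate k 0#
  reverse-zeros zero = refl
  reverse-zeros (suc k) =
    trans (Listₚ.unfold-reverse 0# (replicate k 0#))
          (trans (cong (_++ 0# ∷ []) (reverse-zeros k)) (zeros-snoc k))
    where
      zeros-snoc : ∀ k → replicate k 0# ++ 0# ∷ [] ≡ 0# ∷ replicate k 0#
      zeros-snoc zero = refl
      zeros-snoc (suc k) = cong (0# ∷_) (zeros-snoc k)

  revPad-[] : ∀ n → revPad n [] ∼ []
  revPad-[] n = subst (_∼ []) (sym (reverse-zeros n)) (zeros∼[] n)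

  revPad-shift : ∀ k n p → length p ≤ n → revPad (k ℕ.+ n) p ≡ shift k (revPad n p)
  revPad-shift k n p |p|≤n = begin
    reverse (p ++ replicate (k ℕ.+ n ∸ length p) 0#)
      ≡⟨ cong (λ j → reverse (p ++ replicate j 0#)) (trans (ℕₚ.+-∸-assoc k |p|≤n) (ℕₚ.+-comm k (n ∸ length p))) ⟩
    reverse (p ++ replicate (n ∸ length p ℕ.+ k) 0#)
      ≡⟨ cong (λ r → reverse (p ++ r)) (replicate-+ (n ∸ length p) k 0#) ⟩
    reverse (p ++ (replicate (n ∸ length p) 0# ++ replicate k 0#))
      ≡⟨ cong reverse (sym (Listₚ.++-assoc p (replicate (n ∸ length p) 0#) (replicate k 0#))) ⟩
    reverse (padTo n p ++ replicate k 0#)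
      ≡⟨ Listₚ.reverse-++ (padTo n p) (replicate k 0#) ⟩
    reverse (replicate k 0#) ++ revPad n p
      ≡⟨ cong (_++ revPad n p) (reverse-zeros k) ⟩
    shift k (revPad n p) ∎
    where open ≡-Reasoning

  revPad-scale : ∀ n c p → revPad n (scale c p) ≡ scale c (revPad n p)
  revPad-scale n c p = trans (cong reverse padded) (sym (Listₚ.reverse-map (c *_) (padTo n p)))
    where
      padded : padTo n (scale c p) ≡ scale c (padTo n p)
      padded = begin
        scale c p ++ replicate (n ∸ length (scale c p)) 0#
          ≡⟨ cong (λ j → scale c p ++ replicate (n ∸ j) 0#) (length-scale c p) ⟩
        scale c p ++ replicate (n ∸ length p) 0#
          ≡⟨ cong (λ x → scale c p ++ replicate (n ∸ length p) x) (sym (zeroʳ c)) ⟩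
        scale c p ++ replicate (n ∸ length p) (c * 0#)
          ≡⟨ cong (scale c p ++_) (sym (Listₚ.map-replicate (c *_) (n ∸ length p) 0#)) ⟩
        scale c p ++ scale c (replicate (n ∸ length p) 0#)
          ≡⟨ sym (Listₚ.map-++ (c *_) p (replicate (n ∸ length p) 0#)) ⟩
        scale c (padTo n p) ∎
        where open ≡-Reasoning

  ++-congʳ : ∀ g {p q} → p ∼ q → g ++ p ∼ g ++ q
  ++-congʳ [] p∼q = p∼q
  ++-congʳ (x ∷ g) p∼q = cons refl (++-congʳ g p∼q)

  revPad-⊗ : ∀ p q a b → length p ≤ a → length q ≤ suc b →
             revPad (a ℕ.+ b) (p ⊗ q) ∼ revPad a p ⊗ revPad (suc b) q
  revPad-⊗ [] q a b _ _ = ∼-trans (revPad-[] (a ℕ.+ b)) (∼-sym (⊗-congˡ (revPad (suc b) q) (revPad-[] a)))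
  revPad-⊗ (x ∷ xs) q (suc a) b (s≤s |xs|≤a) |q|≤1+b = begin
    revPad (suc N) (scale x q ⊕ (0# ∷ xs ⊗ q))
      ≡⟨ revPad-⊕ (suc N) (scale x q) (0# ∷ xs ⊗ q) |xq|≤ |0xsq|≤ ⟩
    revPad (suc N) (scale x q) ⊕ revPad (suc N) (0# ∷ xs ⊗ q)
      ≡⟨ cong₂ _⊕_ head-term (revPad-∷ N 0# (xs ⊗ q)) ⟩
    shift a (scale x Q) ⊕ (revPad N (xs ⊗ q) ++ 0# ∷ [])
      ≈⟨ ⊕-congʳ (shift a (scale x Q)) tail-term ⟩
    shift a (scale x Q) ⊕ revPad a xs ⊗ Q
      ≡⟨ ⊕-comm (shift a (scale x Q)) (revPad a xs ⊗ Q) ⟩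
    revPad a xs ⊗ Q ⊕ shift a (scale x Q)
      ≈⟨ ⊕-congʳ (revPad a xs ⊗ Q) (∼-sym (∼-trans (shift-⊗ a (x ∷ []) Q) (shift-cong a (const-⊗ x Q)))) ⟩
    revPad a xs ⊗ Q ⊕ shift a (x ∷ []) ⊗ Q
      ≈⟨ ∼-sym (⊗-distribʳ (revPad a xs) (shift a (x ∷ [])) Q) ⟩
    (revPad a xs ⊕ shift a (x ∷ [])) ⊗ Q
      ≡⟨ cong (_⊗ Q) (sym revPad-x∷xs) ⟩
    revPad (suc a) (x ∷ xs) ⊗ Q ∎
    where
      open ∼-Reasoning
      N = a ℕ.+ b
      Q = revPad (suc b) q
      |xq|≤ : length (scale x q) ≤ suc N
      |xq|≤ = subst (_≤ suc N) (sym (length-scale x q)) (ℕₚ.≤-trans |q|≤1+b (s≤s (ℕₚ.m≤n+m b a)))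
      |0xsq|≤ : length (0# ∷ xs ⊗ q) ≤ suc N
      |0xsq|≤ = s≤s (ℕₚ.≤-trans (length-⊗ xs q) (ℕₚ.+-mono-≤ |xs|≤a (ℕₚ.pred-mono-≤ |q|≤1+b)))
      head-term : revPad (suc N) (scale x q) ≡ shift a (scale x Q)
      head-term =
        trans (cong (λ k → revPad k (scale x q)) (sym (ℕₚ.+-suc a b)))
        (trans (revPad-shift a (suc b) (scale x q) (subst (_≤ suc b) (sym (length-scale x q)) |q|≤1+b))
               (cong (shift a) (revPad-scale (suc b) x q)))
      tail-term : revPad N (xs ⊗ q) ++ 0# ∷ [] ∼ revPad a xs ⊗ Q
      tail-term = ∼-trans (∼-trans (++-congʳ (revPad N (xs ⊗ q)) (0∷∼[] refl nil)) (≡⇒∼ (Listₚ.++-identityʳ _)))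
                          (revPad-⊗ xs q a b |xs|≤a |q|≤1+b)
      revPad-x∷xs : revPad (suc a) (x ∷ xs) ≡ revPad a xs ⊕ shift a (x ∷ [])
      revPad-x∷xs = trans (revPad-∷ a x xs)
        (trans (++-as-⊕ (revPad a xs) (x ∷ [])) (cong (λ k → revPad a xs ⊕ shift k (x ∷ [])) (length-revPad a xs |xs|≤a)))

  *-cong : ∀ {p q} → p ∼ q → p * ≡ q *
  *-cong p∼q = cong reverse (∼⇒≈ p∼q)

  reverse-⊗-normal : ∀ P Q → lead P ≢ 0# → lead Q ≢ 0# → reverse (P ⊗ Q) ∼ reverse P ⊗ reverse Q
  reverse-⊗-normal P [] _ Q≢0 = ⊥-elim (Q≢0 refl)
  reverse-⊗-normal P Q@(q ∷ qs) P≢0 Q≢0 = begin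
    reverse (P ⊗ Q)                           ≡⟨ sym (trans (cong (λ k → revPad k (P ⊗ Q)) (sym |PQ|)) (revPad-full (P ⊗ Q))) ⟩
    revPad (length P ℕ.+ length qs) (P ⊗ Q)   ≈⟨ revPad-⊗ P Q (length P) (length qs) ℕₚ.≤-refl ℕₚ.≤-refl ⟩
    revPad (length P) P ⊗ revPad (length Q) Q ≡⟨ cong₂ _⊗_ (revPad-full P) (revPad-full Q) ⟩
    reverse P ⊗ reverse Q                     ∎
    where
      open ∼-Reasoning
      |PQ| : length (P ⊗ Q) ≡ length P ℕ.+ length qs
      |PQ| = ℕₚ.suc-injective (trans (proj₂ (⊗-lead P Q P≢0 Q≢0)) (ℕₚ.+-suc (length P) (length qs)))

  ⊗-normal : ∀ P Q → lead P ≢ 0# → lead Q ≢ 0# → lead (P ⊗ Q) ≢ 0#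
  ⊗-normal P Q P≢0 Q≢0 lead≡0 = *-nonzero P≢0 Q≢0 (trans (sym (proj₁ (⊗-lead P Q P≢0 Q≢0))) lead≡0)

  reverse-⊗ : ∀ p q → (p ⊗ q) * ∼ (p *) ⊗ (q *)
  reverse-⊗ p q with norm-zero-or-normal p | norm-zero-or-normal q
  ... | inj₁ p≈0 | _ =
    subst₂ _∼_ (sym (*-cong {p ⊗ q} (⊗-congˡ q (∼-norm′ p p≈0)))) (cong (λ r → reverse r ⊗ (q *)) (sym p≈0)) nil
  ... | inj₂ _ | inj₁ q≈0 =
    subst₂ _∼_ (sym (*-cong {p ⊗ q} (∼-trans (⊗-congʳ p (∼-norm′ q q≈0)) (⊗-zeroʳ p))))
               (cong (λ r → (p *) ⊗ reverse r) (sym q≈0)) (∼-sym (⊗-zeroʳ (p *)))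
  ... | inj₂ P≢0 | inj₂ Q≢0 = begin
    (p ⊗ q) *                          ≡⟨ *-cong {p ⊗ q} (⊗-cong (∼-norm p) (∼-norm q)) ⟩
    reverse (norm (norm p ⊗ norm q))   ≡⟨ cong reverse (norm-normal (norm p ⊗ norm q) (⊗-normal (norm p) (norm q) P≢0 Q≢0)) ⟩
    reverse (norm p ⊗ norm q)          ≈⟨ reverse-⊗-normal (norm p) (norm q) P≢0 Q≢0 ⟩
    (p *) ⊗ (q *)                      ∎
    where open ∼-Reasoning

  -- Size (= degree + 1 for p ≠ 0, and 0 for p = 0) and units

  size : Pol → ℕ
  size p = length (norm p)

  size-∼ : ∀ {p q} → p ∼ q → size p ≡ size q
  size-∼ p∼q = cong length (∼⇒≈ p∼q)

  size≡0⇒≈0 : ∀ p → size p ≡ 0 → p ≈ []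
  size≡0⇒≈0 p size≡0 with norm p
  ... | [] = refl
  ... | _ ∷ _ = ⊥-elim (ℕₚ.1+n≢0 size≡0)

  normal⇒nonempty : ∀ n → lead n ≢ 0# → 0 < length n
  normal⇒nonempty [] lead≢0 = ⊥-elim (lead≢0 refl)
  normal⇒nonempty (_ ∷ _) _ = s≤s z≤n

  nonzero⇒normal : ∀ p → ¬ p ≈ [] → lead (norm p) ≢ 0#
  nonzero⇒normal p p≉0 with norm-zero-or-normal p
  ... | inj₁ p≈0 = ⊥-elim (p≉0 p≈0)
  ... | inj₂ lead≢0 = lead≢0

  size-scale : ∀ {c} p → c ≢ 0# → size (scale c p) ≡ size p
  size-scale {c} p c≢0 with norm-zero-or-normal p
  ... | inj₁ p≈0 = trans (size-∼ (∼-trans (scale-cong c (∼-norm′ p p≈0)) nil)) (sym (cong length p≈0))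
  ... | inj₂ lead≢0 = begin
    size (scale c p)              ≡⟨ size-∼ (scale-cong c (∼-norm p)) ⟩
    length (norm (scale c (norm p))) ≡⟨ cong length (norm-normal (scale c (norm p)) scaled-lead) ⟩
    length (scale c (norm p))     ≡⟨ length-scale c (norm p) ⟩
    size p                        ∎
    where
      open ≡-Reasoning
      scaled-lead : lead (scale c (norm p)) ≢ 0#
      scaled-lead lead≡0 = *-nonzero c≢0 lead≢0 (trans (sym (lead-scale c (norm p))) lead≡0)

  size-⊗ : ∀ p q → lead (norm p) ≢ 0# → lead (norm q) ≢ 0# → suc (size (p ⊗ q)) ≡ size p ℕ.+ size q
  size-⊗ p q P≢0 Q≢0 = trans (cong suc size-PQ) (proj₂ (⊗-lead (norm p) (norm q) P≢0 Q≢0))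
    where
      size-PQ : size (p ⊗ q) ≡ length (norm p ⊗ norm q)
      size-PQ = trans (size-∼ (⊗-cong (∼-norm p) (∼-norm q)))
                      (cong length (norm-normal (norm p ⊗ norm q) (⊗-normal (norm p) (norm q) P≢0 Q≢0)))

  size-one : size one ≡ 1
  size-one = cong length (norm-normal one 1≢0)

  unit⇒size≡1 : ∀ x → IsUnit x → size x ≡ 1
  unit⇒size≡1 x (v , xv≈1) = by-cases (norm-zero-or-normal x) (norm-zero-or-normal v)
    where
      size-xv : size (x ⊗ v) ≡ 1
      size-xv = trans (cong length xv≈1) size-one
      sizes-of-unit : ∀ m n → 0 < m → 0 < n → m ℕ.+ n ≡ 2 → m ≡ 1
      sizes-of-unit (suc zero) _ _ _ _ = refl
      sizes-of-unit (suc (suc m)) (suc n) _ _ m+n≡2 =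
        ⊥-elim (ℕₚ.1+n≢0 (trans (sym (ℕₚ.+-suc m n)) (ℕₚ.suc-injective (ℕₚ.suc-injective m+n≡2))))
      by-cases : norm x ≡ [] ⊎ lead (norm x) ≢ 0# → norm v ≡ [] ⊎ lead (norm v) ≢ 0# → size x ≡ 1
      by-cases (inj₁ x≈0) _ = ⊥-elim (ℕₚ.0≢1+n (trans (sym (size-∼ (⊗-congˡ v (∼-norm′ x x≈0)))) size-xv))
      by-cases (inj₂ _) (inj₁ v≈0) =
        ⊥-elim (ℕₚ.0≢1+n (trans (sym (size-∼ (∼-trans (⊗-congʳ x (∼-norm′ v v≈0)) (⊗-zeroʳ x)))) size-xv))
      by-cases (inj₂ X≢0) (inj₂ V≢0) =
        sizes-of-unit (size x) (size v) (normal⇒nonempty (norm x) X≢0) (normal⇒nonempty (norm v) V≢0)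
          (trans (sym (size-⊗ x v X≢0 V≢0)) (cong suc size-xv))

  size≡1⇒unit : ∀ x → size x ≡ 1 → IsUnit x
  size≡1⇒unit x size≡1 with norm x | norm-zero-or-normal x | ∼-norm x
  ... | c ∷ [] | inj₂ c≢0 | x∼c with inverse c c≢0
  ...   | c⁻¹ , cc⁻¹≡1 =
    c⁻¹ ∷ [] , ∼⇒≈ (∼-trans (⊗-congˡ (c⁻¹ ∷ []) x∼c) (∼-trans (const-⊗ c (c⁻¹ ∷ [])) (cons cc⁻¹≡1 nil)))

  -- Irreducibility under scaling and reversal

  irreducible-transfer :
    ∀ P P′ → size P′ ≡ size P →
    (∀ g h → P′ ≈ g ⊗ h → ∃ λ g′ → ∃ λ h′ → P ≈ g′ ⊗ h′ × size g′ ≡ size g × size h′ ≡ size h) →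
    Irreducible P → Irreducible P′
  irreducible-transfer P P′ same-size factor (P-nonunit , P≉0 , P-irreducible) = nonunit , nonzero , irreducible
    where
      nonunit : ¬ IsUnit P′
      nonunit U = P-nonunit (size≡1⇒unit P (trans (sym same-size) (unit⇒size≡1 P′ U)))
      nonzero : ¬ P′ ≈ []
      nonzero P′≈0 = P≉0 (size≡0⇒≈0 P (trans (sym same-size) (cong length P′≈0)))
      irreducible : ∀ g h → P′ ≈ g ⊗ h → IsUnit g ⊎ IsUnit h
      irreducible g h P′≈gh with factor g h P′≈gh
      ... | g′ , h′ , P≈g′h′ , size-g , size-h with P-irreducible g′ h′ P≈g′h′
      ...   | inj₁ U = inj₁ (size≡1⇒unit g (trans (sym size-g) (unit⇒size≡1 g′ U)))
      ...   | inj₂ U = inj₂ (size≡1⇒unit h (trans (sym size-h) (unit⇒size≡1 h′ U)))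

  inverse-nonzero : ∀ {c d} → c * d ≡ 1# → d ≢ 0#
  inverse-nonzero {c} cd≡1 d≡0 = 0≢1 (trans (sym (zeroʳ c)) (trans (cong (c *_) (sym d≡0)) cd≡1))

  irreducible-scale : ∀ {c} P → c ≢ 0# → Irreducible P → Irreducible (scale c P)
  irreducible-scale {c} P c≢0 = irreducible-transfer P (scale c P) (size-scale P c≢0) factor
    where
      c⁻¹ = proj₁ (inverse c c≢0)
      c⁻¹c≡1 : c⁻¹ * c ≡ 1#
      c⁻¹c≡1 = trans (*-comm c⁻¹ c) (proj₂ (inverse c c≢0))
      factor : ∀ g h → scale c P ≈ g ⊗ h → ∃ λ g′ → ∃ λ h′ → P ≈ g′ ⊗ h′ × size g′ ≡ size g × size h′ ≡ size h
      factor g h cP≈gh = scale c⁻¹ g , h , ∼⇒≈ P∼ , size-scale g (inverse-nonzero (proj₂ (inverse c c≢0))) , refl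
        where
          open ∼-Reasoning
          P∼ : P ∼ scale c⁻¹ g ⊗ h
          P∼ = begin
            P                       ≡⟨ sym (scale-inverse P c⁻¹c≡1) ⟩
            scale c⁻¹ (scale c P)   ≈⟨ scale-cong c⁻¹ (≈⇒∼ (scale c P) (g ⊗ h) cP≈gh) ⟩
            scale c⁻¹ (g ⊗ h)       ≈⟨ scale-⊗ˡ c⁻¹ g h ⟩
            scale c⁻¹ g ⊗ h         ∎

  coeff0-norm : ∀ p → coeff0 (norm p) ≡ coeff0 p
  coeff0-norm p = sym (coeff0-∼ (∼-norm p))

  -- For p(0) ≠ 0 the list p* is normalised, so reversal preserves size and is an involution.
  norm-reverse : ∀ p → coeff0 p ≢ 0# → norm (p *) ≡ p *
  norm-reverse p p0≢0 = norm-normal (p *) (λ lead≡0 → p0≢0 (trans (sym (coeff0-norm p)) (trans (sym (lead-reverse (norm p))) lead≡0)))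

  size-reverse : ∀ p → coeff0 p ≢ 0# → size (p *) ≡ size p
  size-reverse p p0≢0 = trans (cong length (norm-reverse p p0≢0)) (Listₚ.length-reverse (norm p))

  reverse-reverse : ∀ p → coeff0 p ≢ 0# → (p *) * ≡ norm p
  reverse-reverse p p0≢0 = trans (cong reverse (norm-reverse p p0≢0)) (Listₚ.reverse-involutive (norm p))

  coeff0-* : ∀ p → ¬ p ≈ [] → coeff0 (p *) ≢ 0#
  coeff0-* p p≉0 = subst (_≢ 0#) (sym (coeff0-reverse (norm p))) (nonzero⇒normal p p≉0)

  product-nonzero⁻¹ : ∀ {x y} → x * y ≢ 0# → x ≢ 0# × y ≢ 0#
  product-nonzero⁻¹ {x} {y} xy≢0 =
    (λ x≡0 → xy≢0 (trans (cong (λ t → t * y) x≡0) (zeroˡ y))) , (λ y≡0 → xy≢0 (trans (cong (x *_) y≡0) (zeroʳ x)))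

  irreducible-reverse : ∀ P → coeff0 P ≢ 0# → Irreducible P → Irreducible (P *)
  irreducible-reverse P P0≢0 irr@(_ , P≉0 , _) = irreducible-transfer P (P *) (size-reverse P P0≢0) factor irr
    where
      factor : ∀ g h → P * ≈ g ⊗ h → ∃ λ g′ → ∃ λ h′ → P ≈ g′ ⊗ h′ × size g′ ≡ size g × size h′ ≡ size h
      factor g h P*≈gh = g * , h * , ∼⇒≈ P∼ , size-reverse g (proj₁ g0h0≢0) , size-reverse h (proj₂ g0h0≢0)
        where
          open ∼-Reasoning
          g0h0≢0 : coeff0 g ≢ 0# × coeff0 h ≢ 0#
          g0h0≢0 = product-nonzero⁻¹ (subst (_≢ 0#) (trans (coeff0-∼ (≈⇒∼ (P *) (g ⊗ h) P*≈gh)) (coeff0-⊗ g h)) (coeff0-* P P≉0))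
          P∼ : P ∼ (g *) ⊗ (h *)
          P∼ = begin
            P            ≈⟨ ∼-norm P ⟩
            norm P       ≡⟨ sym (reverse-reverse P P0≢0) ⟩
            (P *) *      ≡⟨ *-cong {P *} (≈⇒∼ (P *) (g ⊗ h) P*≈gh) ⟩
            (g ⊗ h) *    ≈⟨ reverse-⊗ g h ⟩
            (g *) ⊗ (h *) ∎

  pow-cong : ∀ k {p q} → p ∼ q → pow p k ∼ pow q k
  pow-cong zero p∼q = ∼-refl
  pow-cong (suc k) p∼q = ⊗-cong p∼q (pow-cong k p∼q)

  coeff0-pow : ∀ p k → coeff0 (pow p k) ≡ power (coeff0 p) k
  coeff0-pow p zero = refl
  coeff0-pow p (suc k) = trans (coeff0-⊗ p (pow p k)) (cong (coeff0 p *_) (coeff0-pow p k))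

  pow-scale : ∀ c p k → pow (scale c p) k ∼ scale (power c k) (pow p k)
  pow-scale c p zero = ≡⇒∼ (sym (scale-1 one))
  pow-scale c p (suc k) = begin
    scale c p ⊗ pow (scale c p) k                  ≈⟨ ⊗-congʳ (scale c p) (pow-scale c p k) ⟩
    scale c p ⊗ scale (power c k) (pow p k)        ≈⟨ ∼-sym (scale-⊗ʳ (power c k) (scale c p) (pow p k)) ⟩
    scale (power c k) (scale c p ⊗ pow p k)        ≈⟨ scale-cong (power c k) (∼-sym (scale-⊗ˡ c p (pow p k))) ⟩
    scale (power c k) (scale c (p ⊗ pow p k))      ≡⟨ scale-scale (power c k) c (p ⊗ pow p k) ⟩
    scale (power c k * c) (p ⊗ pow p k)            ≡⟨ cong (λ d → scale d (p ⊗ pow p k)) (*-comm (power c k) c) ⟩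
    scale (c * power c k) (p ⊗ pow p k)            ∎
    where open ∼-Reasoning

  reverse-const : ∀ c → (c ∷ []) * ∼ c ∷ []
  reverse-const c with c ≟ 0#
  ... | yes c≡0 = []∼0∷ c≡0 nil
  ... | no _ = ∼-refl

  reverse-scale : ∀ c p → (scale c p) * ∼ scale c (p *)
  reverse-scale c p = begin
    (scale c p) *         ≡⟨ *-cong {scale c p} (∼-sym (const-⊗ c p)) ⟩
    ((c ∷ []) ⊗ p) *      ≈⟨ reverse-⊗ (c ∷ []) p ⟩
    ((c ∷ []) *) ⊗ (p *)  ≈⟨ ⊗-congˡ (p *) (reverse-const c) ⟩
    (c ∷ []) ⊗ (p *)      ≈⟨ const-⊗ c (p *) ⟩
    scale c (p *)         ∎
    where open ∼-Reasoning

  reverse-pow : ∀ p k → (pow p k) * ∼ pow (p *) k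
  reverse-pow p zero = reverse-const 1#
  reverse-pow p (suc k) = ∼-trans (reverse-⊗ p (pow p k)) (⊗-congʳ (p *) (reverse-pow p k))

  record ReversalAssociate (P : Pol) : Set where
    field
      P′          : Pol
      monic       : Monic P′
      irreducible : Irreducible P′
      same-degree : deg P′ ≡ deg P
      reversal    : P * ≡ scale (coeff0 P) P′

  reversal-associate : ∀ P → Irreducible P → coeff0 P ≢ 0# → ReversalAssociate P
  reversal-associate P irr P0≢0 = record
    { P′ = P′
    ; monic = trans (cong last (norm-normal P′ lead≢0)) (trans (last-lead P′ lead≢0) (cong just lead≡1))
    ; irreducible = irreducible-scale (P *) u≢0 (irreducible-reverse P P0≢0 irr)
    ; same-degree = cong (_∸ 1) (trans (size-scale (P *) u≢0) (size-reverse P P0≢0))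
    ; reversal = sym (scale-inverse (P *) P0u≡1)
    }
    where
      u = proj₁ (inverse (coeff0 P) P0≢0)
      P0u≡1 : coeff0 P * u ≡ 1#
      P0u≡1 = proj₂ (inverse (coeff0 P) P0≢0)
      u≢0 : u ≢ 0#
      u≢0 = inverse-nonzero P0u≡1
      P′ = scale u (P *)
      lead≡1 : lead P′ ≡ 1#
      lead≡1 = begin
        lead (scale u (P *))   ≡⟨ lead-scale u (P *) ⟩
        u * lead (P *)         ≡⟨ cong (u *_) (trans (lead-reverse (norm P)) (coeff0-norm P)) ⟩
        u * coeff0 P           ≡⟨ *-comm u (coeff0 P) ⟩
        coeff0 P * u           ≡⟨ P0u≡1 ⟩
        1#                     ∎
        where open ≡-Reasoning
      lead≢0 : lead P′ ≢ 0#
      lead≢0 lead≡0 = 1≢0 (trans (sym lead≡1) lead≡0)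

  _⇝_ : Pol → Pol → Set
  f ⇝ g = ∀ c P k → PrimePowerRep f c P k → ∃ λ c′ → ∃ λ P′ → PrimePowerRep g c′ P′ k × deg P′ ≡ deg P

  ⇝-trans : ∀ {f g h} → f ⇝ g → g ⇝ h → f ⇝ h
  ⇝-trans f⇝g g⇝h c P k rep with f⇝g c P k rep
  ... | c′ , P′ , rep′ , same-degree with g⇝h c′ P′ k rep′
  ...   | c″ , P″ , rep″ , same-degree′ = c″ , P″ , rep″ , trans same-degree′ same-degree

  ∼-⇝ : ∀ {f g} → f ∼ g → f ⇝ g
  ∼-⇝ f∼g c P k (c≢0 , monic , irr , k≥1 , f≈cPᵏ) = c , P , (c≢0 , monic , irr , k≥1 , trans (sym (∼⇒≈ f∼g)) f≈cPᵏ) , refl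

  prime-power-reverse : ∀ f → coeff0 f ≢ 0# → f ⇝ (f *)
  prime-power-reverse f f0≢0 c P k (_ , _ , irr , k≥1 , f≈cPᵏ) =
    c * power p0 k , P′ , (c′≢0 , monic , irreducible , k≥1 , ∼⇒≈ f*∼) , same-degree
    where
      p0 = coeff0 P
      c′≢0 : c * power p0 k ≢ 0#
      c′≢0 = subst (_≢ 0#) (trans (coeff0-∼ (≈⇒∼ f (scale c (pow P k)) f≈cPᵏ)) (trans (coeff0-scale c (pow P k)) (cong (c *_) (coeff0-pow P k)))) f0≢0
      p0≢0 : p0 ≢ 0#
      p0≢0 = power-nonzero⁻¹ p0 k k≥1 (proj₂ (product-nonzero⁻¹ c′≢0))
      open ReversalAssociate (reversal-associate P irr p0≢0)
      open ∼-Reasoning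
      f*∼ : f * ∼ scale (c * power p0 k) (pow P′ k)
      f*∼ = begin
        f *                                       ≡⟨ *-cong {f} (≈⇒∼ f (scale c (pow P k)) f≈cPᵏ) ⟩
        (scale c (pow P k)) *                     ≈⟨ reverse-scale c (pow P k) ⟩
        scale c ((pow P k) *)                     ≈⟨ scale-cong c (reverse-pow P k) ⟩
        scale c (pow (P *) k)                     ≡⟨ cong (λ Q → scale c (pow Q k)) reversal ⟩
        scale c (pow (scale p0 P′) k)             ≈⟨ scale-cong c (pow-scale p0 P′ k) ⟩
        scale c (scale (power p0 k) (pow P′ k))   ≡⟨ scale-scale c (power p0 k) (pow P′ k) ⟩
        scale (c * power p0 k) (pow P′ k)         ∎


  sumOf-allLists-suc : ∀ (φ : Pol → ℕ) m →
    sumOf φ (allLists (suc m)) ≡ sumOf (λ x → sumOf (λ g → φ (x ∷ g)) (allLists m)) elems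
  sumOf-allLists-suc φ m =
    trans (sumOf-concatMap φ (λ x → map (x ∷_) (allLists m)) elems)
          (sumOf-cong (λ x → sumOf-map φ (x ∷_) (allLists m)) elems)

  allLists-cong : ∀ {φ ψ : Pol → ℕ} m → (∀ g → length g ≡ m → φ g ≡ ψ g) →
                  sumOf φ (allLists m) ≡ sumOf ψ (allLists m)
  allLists-cong zero φ≡ψ = cong (ℕ._+ 0) (φ≡ψ [] refl)
  allLists-cong {φ} {ψ} (suc m) φ≡ψ =
    trans (sumOf-allLists-suc φ m)
    (trans (sumOf-cong (λ x → allLists-cong m (λ g |g| → φ≡ψ (x ∷ g) (cong suc |g|))) elems)
           (sym (sumOf-allLists-suc ψ m)))

  allLists-split : ∀ (φ : Pol → ℕ) m k →
    sumOf φ (allLists (m ℕ.+ k)) ≡ sumOf (λ p → sumOf (λ g → φ (p ++ g)) (allLists k)) (allLists m)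
  allLists-split φ zero k = sym (ℕₚ.+-identityʳ _)
  allLists-split φ (suc m) k =
    trans (sumOf-allLists-suc φ (m ℕ.+ k))
    (trans (sumOf-cong (λ x → allLists-split (λ g → φ (x ∷ g)) m k) elems)
           (sym (sumOf-allLists-suc (λ p → sumOf (λ g → φ (p ++ g)) (allLists k)) m)))

  allLists-point : ∀ (ψ : Pol → ℕ) m b → length b ≡ m →
                   (∀ p → length p ≡ m → p ≢ b → ψ p ≡ 0) → sumOf ψ (allLists m) ≡ ψ b
  allLists-point ψ zero [] _ _ = ℕₚ.+-identityʳ _
  allLists-point ψ (suc m) (b ∷ bs) |b∷bs| off =
    trans (sumOf-allLists-suc ψ m)
    (trans (sumOf-point (λ x → sumOf (λ g → ψ (x ∷ g)) (allLists m)) unique (complete b) other-heads)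
           (allLists-point (λ g → ψ (b ∷ g)) m bs (ℕₚ.suc-injective |b∷bs|)
              (λ g |g| g≢bs → off (b ∷ g) (cong suc |g|) (λ e → g≢bs (proj₂ (Listₚ.∷-injective e))))))
    where
      other-heads : ∀ x → x ≢ b → sumOf (λ g → ψ (x ∷ g)) (allLists m) ≡ 0
      other-heads x x≢b =
        trans (allLists-cong {ψ = λ _ → 0} m
                 (λ g |g| → off (x ∷ g) (cong suc |g|) (λ e → x≢b (proj₁ (Listₚ.∷-injective e)))))
              (sumOf-zero (allLists m))

  allLists-snoc : ∀ (φ : Pol → ℕ) k →
    sumOf φ (allLists (suc k)) ≡ sumOf (λ g → sumOf (λ x → φ (g ++ x ∷ [])) elems) (allLists k)
  allLists-snoc φ k =
    trans (cong (λ j → sumOf φ (allLists j)) (ℕₚ.+-comm 1 k))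
    (trans (allLists-split φ k 1)
           (sumOf-cong (λ g → trans (sumOf-allLists-suc (λ q → φ (g ++ q)) 0)
                                    (sumOf-cong (λ x → ℕₚ.+-identityʳ _) elems))
                       (allLists k)))

  allLists-reverse : ∀ (φ : Pol → ℕ) k → sumOf (λ g → φ (reverse g)) (allLists k) ≡ sumOf φ (allLists k)
  allLists-reverse φ zero = refl
  allLists-reverse φ (suc k) = begin
    sumOf (λ g → φ (reverse g)) (allLists (suc k))
      ≡⟨ sumOf-allLists-suc (λ g → φ (reverse g)) k ⟩
    sumOf (λ x → sumOf (λ g → φ (reverse (x ∷ g))) (allLists k)) elems
      ≡⟨ sumOf-cong (λ x → trans (sumOf-cong (λ g → cong φ (Listₚ.unfold-reverse x g)) (allLists k))
                                 (allLists-reverse (λ g → φ (g ++ x ∷ [])) k)) elems ⟩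
    sumOf (λ x → sumOf (λ g → φ (g ++ x ∷ [])) (allLists k)) elems
      ≡⟨ sumOf-swap (λ x g → φ (g ++ x ∷ [])) elems (allLists k) ⟩
    sumOf (λ g → sumOf (λ x → φ (g ++ x ∷ [])) elems) (allLists k)
      ≡⟨ sym (allLists-snoc φ k) ⟩
    sumOf φ (allLists (suc k)) ∎
    where open ≡-Reasoning

  -- The tail sum  Σ_{|g| = h + 1, deg g = h} Λ(R ++ g),  the common value of both sides

  tailTerm : (Pol → ℕ) → Pol → Pol → ℕ
  tailTerm Λ R g = if does (lead g ≟ 0#) then 0 else Λ (R ++ g)

  tailSum : (Pol → ℕ) → Pol → ℕ → ℕ
  tailSum Λ R h = sumOf (tailTerm Λ R) (allLists (suc h))

  size-++-normal : ∀ R g → lead g ≢ 0# → size (R ++ g) ≡ length (R ++ g)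
  size-++-normal R g lead≢0 =
    cong length (norm-normal (R ++ g) (subst (_≢ 0#) (sym (lead-++ R (normal⇒nonempty g lead≢0))) lead≢0))

  size-++-lead≡0 : ∀ R y ys → lead (y ∷ ys) ≡ 0# → size (R ++ y ∷ ys) ≢ length (R ++ y ∷ ys)
  size-++-lead≡0 R y ys lead≡0 size≡length = ℕₚ.<-irrefl refl (subst (_≤ length (R ++ ys)) size≡suc shrunk)
    where
      size≡suc : size (R ++ y ∷ ys) ≡ suc (length (R ++ ys))
      size≡suc = trans size≡length (Listₚ.length-++-sucʳ R y ys)
      shrunk : size (R ++ y ∷ ys) ≤ length (R ++ ys)
      shrunk = subst (λ L → size (R ++ y ∷ ys) ≤ ℕ.pred L) (Listₚ.length-++-sucʳ R y ys)
                     (length-norm-lead≡0 (R ++ y ∷ ys) (trans (lead-++ R (s≤s z≤n)) lead≡0))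

  neg-cancel : ∀ t → t ⊕ neg t ≡ replicate (length t) 0#
  neg-cancel [] = refl
  neg-cancel (y ∷ t) = cong₂ _∷_ (-‿inverseʳ y) (neg-cancel t)

  difference-zero : ∀ x y → x + - y ≡ 0# → x ≡ y
  difference-zero x y x-y≡0 = begin
    x                ≡⟨ sym (+-identityʳ x) ⟩
    x + 0#           ≡⟨ cong (x +_) (sym (-‿inverseˡ y)) ⟩
    x + (- y + y)    ≡⟨ sym (+-assoc x (- y) y) ⟩
    x + - y + y      ≡⟨ cong (_+ y) x-y≡0 ⟩
    0# + y           ≡⟨ +-identityˡ y ⟩
    y                ∎
    where open ≡-Reasoning

  ++-minus : ∀ p g R → length p ≡ length R → (p ++ g) ⊕ neg R ≡ (p ⊕ neg R) ++ g
  ++-minus p g R |p|≡|R| = begin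
    (p ++ g) ⊕ neg R          ≡⟨ cong ((p ++ g) ⊕_) (sym (Listₚ.++-identityʳ (neg R))) ⟩
    (p ++ g) ⊕ (neg R ++ [])  ≡⟨ ++-⊕ p (neg R) g [] (trans |p|≡|R| (sym (Listₚ.length-map -_ R))) ⟩
    (p ⊕ neg R) ++ (g ⊕ [])   ≡⟨ cong ((p ⊕ neg R) ++_) (⊕-identityʳ g) ⟩
    (p ⊕ neg R) ++ g          ∎
    where open ≡-Reasoning

  divides-self : ∀ R g → Divides (Tpow (length R)) ((R ++ g) ⊕ neg R)
  divides-self R g = g , ∼⇒≈ (begin
    (R ++ g) ⊕ neg R     ≡⟨ ++-minus R g R refl ⟩
    (R ⊕ neg R) ++ g     ≡⟨ cong (_++ g) (neg-cancel R) ⟩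
    shift (length R) g   ≈⟨ ∼-sym (Tpow-⊗ (length R) g) ⟩
    Tpow (length R) ⊗ g  ∎)
    where open ∼-Reasoning

  divides⇒prefix : ∀ R p g → length p ≡ length R → Divides (Tpow (length R)) ((p ++ g) ⊕ neg R) → p ≡ R
  divides⇒prefix R p g |p|≡|R| (u , R∣p++g-R) = low-terms-vanish p R |p|≡|R| (begin
    (p ⊕ neg R) ++ g      ≡⟨ sym (++-minus p g R |p|≡|R|) ⟩
    (p ++ g) ⊕ neg R      ≈⟨ ≈⇒∼ ((p ++ g) ⊕ neg R) (Tpow (length R) ⊗ u) R∣p++g-R ⟩
    Tpow (length R) ⊗ u   ≈⟨ Tpow-⊗ (length R) u ⟩
    shift (length R) u    ∎)
    where
      open ∼-Reasoning
      low-terms-vanish : ∀ p t → length p ≡ length t → (p ⊕ neg t) ++ g ∼ shift (length t) u → p ≡ t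
      low-terms-vanish [] [] _ _ = refl
      low-terms-vanish (x ∷ p) (y ∷ t) |p|≡|t| (cons x-y≡0 rest) =
        cong₂ _∷_ (difference-zero x y x-y≡0) (low-terms-vanish p t (ℕₚ.suc-injective |p|≡|t|) rest)

  -- Ψ̃(|R| + h; T^{|R|}, R) is the tail sum of R: every f of length |R| + h + 1 is p ++ g,
  -- the congruence forces p = R, and deg f = |R| + h iff deg g = h.
  Ψ̃-as-tailSum : ∀ (Λ : Pol → ℕ) (dec : (Q g : Pol) → Dec (Divides Q g)) R h →
                 Ψ̃ Λ dec (length R ℕ.+ h) (Tpow (length R)) R ≡ tailSum Λ R h
  Ψ̃-as-tailSum Λ dec R h = begin
    sumOf χ (allLists (suc (m ℕ.+ h)))
      ≡⟨ cong (λ j → sumOf χ (allLists j)) (sym (ℕₚ.+-suc m h)) ⟩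
    sumOf χ (allLists (m ℕ.+ suc h))
      ≡⟨ allLists-split χ m (suc h) ⟩
    sumOf (λ p → sumOf (λ g → χ (p ++ g)) (allLists (suc h))) (allLists m)
      ≡⟨ allLists-point (λ p → sumOf (λ g → χ (p ++ g)) (allLists (suc h))) m R refl other-prefix ⟩
    sumOf (λ g → χ (R ++ g)) (allLists (suc h))
      ≡⟨ allLists-cong (suc h) χ≡tailTerm ⟩
    tailSum Λ R h ∎
    where
      open ≡-Reasoning
      m = length R
      χ : Pol → ℕ
      χ f = if does (length (norm f) ℕ.≟ suc (m ℕ.+ h)) ∧ does (dec (Tpow m) (f ⊕ neg R)) then Λ f else 0
      other-prefix : ∀ p → length p ≡ m → p ≢ R → sumOf (λ g → χ (p ++ g)) (allLists (suc h)) ≡ 0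
      other-prefix p |p|≡m p≢R =
        trans (sumOf-cong (λ g → guarded-off (length (norm (p ++ g)) ℕ.≟ suc (m ℕ.+ h)) (dec (Tpow m) ((p ++ g) ⊕ neg R))
                                              (Λ (p ++ g)) (λ R∣ → p≢R (divides⇒prefix R p g |p|≡m R∣)))
                          (allLists (suc h)))
              (sumOf-zero (allLists (suc h)))
      χ≡tailTerm : ∀ g → length g ≡ suc h → χ (R ++ g) ≡ tailTerm Λ R g
      χ≡tailTerm (y ∷ ys) |g| =
        guarded-switch (length (norm (R ++ g)) ℕ.≟ suc (m ℕ.+ h)) (dec (Tpow m) ((R ++ g) ⊕ neg R)) (lead g ≟ 0#)
          (Λ (R ++ g)) (divides-self R g)
          (λ lead≡0 size≡ → size-++-lead≡0 R y ys lead≡0 (trans size≡ (sym |R++g|)))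
          (λ lead≢0 → trans (size-++-normal R g lead≢0) |R++g|)
        where
          g = y ∷ ys
          |R++g| : length (R ++ g) ≡ suc (m ℕ.+ h)
          |R++g| = trans (Listₚ.length-++ R) (trans (cong (m ℕ.+_) |g|) (ℕₚ.+-suc m h))

  shift-⊕ : ∀ k B g → length g ≡ k → shift k B ⊕ g ≡ g ++ B
  shift-⊕ k B g |g|≡k =
    trans (⊕-comm (shift k B) g) (trans (cong (λ j → g ⊕ shift j B) (sym |g|≡k)) (sym (++-as-⊕ g B)))

  *-++ : ∀ g B → ¬ B ≈ [] → (g ++ B) * ≡ (B *) ++ reverse g
  *-++ g B B≉0 = trans (cong reverse norm-g++B) (Listₚ.reverse-++ g (norm B))
    where
      lead≢0 = nonzero⇒normal B B≉0
      norm-g++B : norm (g ++ B) ≡ g ++ norm B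
      norm-g++B = trans (∼⇒≈ (++-congʳ g (∼-norm B)))
        (norm-normal (g ++ norm B) (subst (_≢ 0#) (sym (lead-++ g (normal⇒nonempty (norm B) lead≢0))) lead≢0))

  guarded-cong : ∀ {a b u v} → a ≡ b → (a ≢ 0# → u ≡ v) →
                 (if does (a ≟ 0#) then 0 else u) ≡ (if does (b ≟ 0#) then 0 else v)
  guarded-cong {a} refl u≡v with a ≟ 0#
  ... | yes _ = refl
  ... | no a≢0 = u≡v a≢0

  module VonMangoldt (Λ : Pol → ℕ) (isΛ : IsVonMangoldt Λ) where
    open IsVonMangoldt isΛ

    PrimePower : Pol → Set
    PrimePower f = ∃ λ c → ∃ λ P → ∃ λ k → PrimePowerRep f c P k

    -- Λ only sees the degree of the prime of a prime-power representation.
    -- (Whether f is a prime power is not decidable here, but Λ f ≡ Λ g is.)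
    Λ-transfer : ∀ f g → f ⇝ g → g ⇝ f → Λ f ≡ Λ g
    Λ-transfer f g f⇝g g⇝f = decidable-stable (Λ f ℕ.≟ Λ g) (λ Λf≢Λg → ¬¬-excluded-middle (by-cases Λf≢Λg))
      where
        by-cases : Λ f ≢ Λ g → ¬ Dec (PrimePower f)
        by-cases Λf≢Λg (yes (c , P , k , rep)) with f⇝g c P k rep
        ... | c′ , P′ , rep′ , same-degree =
          Λf≢Λg (trans (on-prime-power f c P k rep) (trans (sym same-degree) (sym (on-prime-power g c′ P′ k rep′))))
        by-cases Λf≢Λg (no ¬pp) = Λf≢Λg (trans (otherwise f ¬pp) (sym (otherwise g ¬pp′)))
          where
            ¬pp′ : ¬ PrimePower g
            ¬pp′ (c , P , k , rep) with g⇝f c P k rep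
            ... | c′ , P′ , rep′ , _ = ¬pp (c′ , P′ , k , rep′)

    Λ-∼ : ∀ {f g} → f ∼ g → Λ f ≡ Λ g
    Λ-∼ f∼g = Λ-transfer _ _ (∼-⇝ f∼g) (∼-⇝ (∼-sym f∼g))

    Λ-reverse : ∀ f → coeff0 f ≢ 0# → Λ (f *) ≡ Λ f
    Λ-reverse f f0≢0 = Λ-transfer (f *) f backward (prime-power-reverse f f0≢0)
      where
        f≉0 : ¬ f ≈ []
        f≉0 f≈0 = f0≢0 (trans (sym (coeff0-norm f)) (cong coeff0 f≈0))
        f**∼f : (f *) * ∼ f
        f**∼f = subst (_∼ f) (sym (reverse-reverse f f0≢0)) (∼-sym (∼-norm f))
        backward : (f *) ⇝ f
        backward = ⇝-trans {f *} {(f *) *} {f} (prime-power-reverse (f *) (coeff0-* f f≉0)) (∼-⇝ f**∼f)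

    -- ν(T^{h+1} B; h) is the tail sum of B*: the summand at g is Λ(g ++ B) = Λ(B* ++ reverse g)
    -- when g(0) ≠ 0, and g(0) is the last entry of reverse g.
    ν-as-tailSum : ∀ h B → ¬ B ≈ [] → ν Λ (Tpow (suc h) ⊗ B) h ≡ tailSum Λ (B *) h
    ν-as-tailSum h B B≉0 =
      trans (allLists-cong {νTerm} {λ g → tailTerm Λ (B *) (reverse g)} (suc h) νTerm≡tailTerm)
            (allLists-reverse (tailTerm Λ (B *)) (suc h))
      where
        A = Tpow (suc h) ⊗ B
        νTerm : Pol → ℕ
        νTerm g = if does (coeff0 (A ⊕ g) ≟ 0#) then 0 else Λ (A ⊕ g)
        νTerm≡tailTerm : ∀ g → length g ≡ suc h → νTerm g ≡ tailTerm Λ (B *) (reverse g)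
        νTerm≡tailTerm g@(y ∷ ys) |g| =
          guarded-cong (trans (coeff0-∼ A⊕g∼g++B) (sym (lead-reverse g))) λ A⊕g₀≢0 → begin
            Λ (A ⊕ g)                ≡⟨ Λ-∼ A⊕g∼g++B ⟩
            Λ (g ++ B)               ≡⟨ sym (Λ-reverse (g ++ B) (λ y≡0 → A⊕g₀≢0 (trans (coeff0-∼ A⊕g∼g++B) y≡0))) ⟩
            Λ ((g ++ B) *)           ≡⟨ cong Λ (*-++ g B B≉0) ⟩
            Λ ((B *) ++ reverse g)   ∎
          where
            open ≡-Reasoning
            A⊕g∼g++B : A ⊕ g ∼ g ++ B
            A⊕g∼g++B = ∼-trans (⊕-congˡ g (Tpow-⊗ (suc h) B)) (≡⇒∼ (shift-⊕ (suc h) B g |g|))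

-- Lemma 4.2

lemma4p2 : (𝔽 : FiniteField) → let open Poly 𝔽 in
    (Λ : Pol → ℕ) → IsVonMangoldt Λ →
    (dec : (Q g : Pol) → Dec (Divides Q g)) →
    (n h : ℕ) → 1 ≤ h → h < n →
    (B : Pol) → HasDegree B (n ∸ h ∸ 1) →
    ν Λ (Tpow (suc h) ⊗ B) h ≡ Ψ̃ Λ dec n (Tpow (n ∸ h)) (B *)
lemma4p2 𝔽 Λ isΛ dec n h _ h<n B deg-B = begin
  ν Λ (Tpow (suc h) ⊗ B) h                                  ≡⟨ ν-as-tailSum h B B≉0 ⟩
  tailSum Λ (B *) h                                         ≡⟨ sym (Ψ̃-as-tailSum Λ dec (B *) h) ⟩
  Ψ̃ Λ dec (length (B *) ℕ.+ h) (Tpow (length (B *))) (B *) ≡⟨ cong (λ m → Ψ̃ Λ dec (m ℕ.+ h) (Tpow m) (B *)) |B*| ⟩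
  Ψ̃ Λ dec (n ∸ h ℕ.+ h) (Tpow (n ∸ h)) (B *)                ≡⟨ cong (λ k → Ψ̃ Λ dec k (Tpow (n ∸ h)) (B *)) (ℕₚ.m∸n+n≡m (ℕₚ.<⇒≤ h<n)) ⟩
  Ψ̃ Λ dec n (Tpow (n ∸ h)) (B *)                            ∎
  where
    open Poly 𝔽
    open PolynomialTheory 𝔽
    open VonMangoldt Λ isΛ
    open ≡-Reasoning
    B≉0 : ¬ B ≈ []
    B≉0 B≈0 = ℕₚ.0≢1+n (trans (sym (cong length B≈0)) deg-B)
    |B*| : length (B *) ≡ n ∸ h
    |B*| = trans (Listₚ.length-reverse (norm B))
             (trans deg-B (trans (sym (ℕₚ.+-comm (n ∸ h ∸ 1) 1)) (ℕₚ.m∸n+n≡m (ℕₚ.m<n⇒0<n∸m h<n))))
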